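{- The set $S_\infty$ is closed under matrix multiplication, and $S_\infty$ is a noncommutative semigroup of countably infinite order with $x\mathbf{0}=\mathbf{0}x=\mathbf{0}$ for every $x\in S_\infty$. For any two nonzero elements $\langle d,k,m\rangle$ and $\langle d',k',m'\rangle$ of $S_\infty$, set $$d''=d+d',\qquad k''=\max(k,k'-d),\qquad m''=\min(m,m'-d).$$ Then $\langle d,k,m\rangle\langle d',k',m'\rangle=\langle d'',k'',m''\rangle$ if $k''\le m''$, and $\langle d,k,m\rangle\langle d',k',m'\rangle=\mathbf{0}$ if $k''>m''$. Moreover, irrespective of whether $k''\le m''$ or not, $1-\min(0,d'')\le k''$.
   Context: An infinite matrix is an array $(x_{ij})_{i,j\in\mathbb{N}}$, $\mathbb{N}=\{1,2,\dots\}$. For integers $d\in\mathbb{Z}$ and $k,m\in\mathbb{N}$ with $1-\min(0,d)\le k\le m$, let $\langle d,k,m\rangle$ denote the infinite matrix with $x_{ij}=1$ if $k\le i\le m$ and $j-i=d$, and $x_{ij}=0$ otherwise (its ones lie on the $d$-th diagonal, $d=0$ being the main diagonal and $d>0$ ($d<0$) diagonals above (below) it, in rows $k$ through $m$, forming an uninterrupted block of $m-k+1$ ones). Let $\mathbf{0}$ be the infinite zero matrix and $S_\infty=\{\mathbf{0}\}\cup\{\langle d,k,m\rangle: d\in\mathbb{Z},\ k,m\in\mathbb{N},\ 1-\min(0,d)\le k\le m\}$, with operation matrix multiplication (well defined since each matrix has finitely many nonzero entries). Distinct admissible triples give distinct matrices. -}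

module Defs where

open import Data.Nat as ℕ using (ℕ; zero; suc)
open import Data.Integer as ℤ using (ℤ; +_; _⊓_; _⊔_)
open import Data.Product using (∃; _×_)
open import Data.Bool using (Bool; true; false; _∧_)
open import Relation.Nullary.Decidable using (⌊_⌋)
open import Relation.Binary.PropositionalEquality using (_≡_)

-- Row/column indices are natural numbers; only indices ≥ 1 are meaningful
-- (index 0 is ignored by matrix equality and by the product).
Mat : Set
Mat = ℕ → ℕ → ℕ

_≐_ : Mat → Mat → Set
A ≐ B = ∀ i j → 1 ℕ.≤ i → 1 ℕ.≤ j → A i j ≡ B i j

𝟎 : Mat
𝟎 _ _ = 0

⟨_,_,_⟩ : ℤ → ℤ → ℤ → Mat
⟨ d , k , m ⟩ i j =
  if' (⌊ k ℤ.≤? + i ⌋ ∧ ⌊ + i ℤ.≤? m ⌋ ∧ ⌊ (+ j ℤ.- + i) ℤ.≟ d ⌋)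
  where
  if' : Bool → ℕ
  if' true  = 1
  if' false = 0

sumTo : ℕ → (ℕ → ℕ) → ℕ
sumTo zero    f = 0
sumTo (suc N) f = sumTo N f ℕ.+ f (suc N)

IsProduct : Mat → Mat → Mat → Set
IsProduct A B C = ∀ i j → 1 ℕ.≤ i → 1 ℕ.≤ j →
  ∃ λ N → ∀ N' → N ℕ.≤ N' → sumTo N' (λ l → A i l ℕ.* B l j) ≡ C i j

-- Elements of S_∞: the zero matrix or an admissible triple ⟨d,k,m⟩ with
-- 1 - min(0,d) ≤ k ≤ m (this forces k ≥ 1, so k, m ∈ ℕ = {1,2,...}).
data S∞ : Set where
  zeroS : S∞
  tri   : (d k m : ℤ) → (+ 1 ℤ.- (+ 0 ⊓ d)) ℤ.≤ k → k ℤ.≤ m → S∞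

toMat : S∞ → Mat
toMat zeroS           = 𝟎
toMat (tri d k m _ _) = ⟨ d , k , m ⟩

module Submission where

-- A nonzero element ⟨d,k,m⟩ is the graph of the partial shift i ↦ i + d defined on the rows
-- k ≤ i ≤ m. A matrix with at most one 1 in each row is the graph of a partial map, and the
-- product of two such graphs is the graph of the composite map: every series Σ_l A_il B_lj has
-- at most one nonzero term. Composing the shift by d on [k,m] with the shift by d' on [k',m']
-- gives the shift by d + d' on those i ∈ [k,m] with i + d ∈ [k',m'], that is on
-- [max(k, k'−d), min(m, m'−d)]. Associativity is then associativity of composition of partial
-- maps, and distinct triples give distinct matrices because a partial shift determines its
-- domain and its displacement.

open import Defs
open import Data.Empty using (⊥-elim)
open import Data.Integer as ℤ using (ℤ; +_; -[1+_]; _⊓_; _⊔_)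
import Data.Integer.Properties as ℤ
open import Data.Integer.Tactic.RingSolver using (solve-∀)
open import Data.Maybe using (Maybe; just; nothing; _>>=_)
open import Data.Maybe.Properties using (just-injective)
open import Data.Nat as ℕ using (ℕ; zero; suc; z≤n; s≤s)
import Data.Nat.Properties as ℕ
open import Data.Product using (∃; _×_; _,_; proj₁; proj₂)
open import Data.Product.Function.NonDependent.Propositional using (_×-↔_)
open import Function using (_∘_; _⇔_; mk⇔; Equivalence)
open import Function.Bundles using (_↔_; mk↔ₛ′; Inverse)
open import Function.Properties.Inverse using (↔-trans)
open import Relation.Nullary using (¬_; Dec; yes; no; contradiction)
open import Relation.Nullary.Decidable using (_×-dec_)
open import Relation.Binary.PropositionalEquality
  using (_≡_; _≢_; refl; sym; trans; cong; cong₂; subst; ≢-sym; module ≡-Reasoning)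

sumTo-cong : ∀ N {f g : ℕ → ℕ} → (∀ l → 1 ℕ.≤ l → f l ≡ g l) → sumTo N f ≡ sumTo N g
sumTo-cong zero    f≡g = refl
sumTo-cong (suc N) f≡g = cong₂ ℕ._+_ (sumTo-cong N f≡g) (f≡g (suc N) (s≤s z≤n))

sumTo-zero : ∀ N {f : ℕ → ℕ} → (∀ l → l ℕ.≤ N → f l ≡ 0) → sumTo N f ≡ 0
sumTo-zero zero    f≡0 = refl
sumTo-zero (suc N) f≡0 =
  cong₂ ℕ._+_ (sumTo-zero N (λ l l≤N → f≡0 l (ℕ.m≤n⇒m≤1+n l≤N))) (f≡0 (suc N) ℕ.≤-refl)

sumTo-single : ∀ N {a} {f : ℕ → ℕ} → (∀ l → l ≢ a → f l ≡ 0) →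
               1 ℕ.≤ a → a ℕ.≤ N → sumTo N f ≡ f a
sumTo-single zero    _ (s≤s _) ()
sumTo-single (suc N) {a} {f} f≡0 1≤a a≤1+N with suc N ℕ.≟ a
... | yes refl = cong (ℕ._+ f (suc N)) (sumTo-zero N (λ l l≤N → f≡0 l (ℕ.<⇒≢ (s≤s l≤N))))
... | no 1+N≢a = begin
  sumTo N f ℕ.+ f (suc N) ≡⟨ cong₂ ℕ._+_ (sumTo-single N f≡0 1≤a a≤N) (f≡0 (suc N) 1+N≢a) ⟩
  f a ℕ.+ 0               ≡⟨ ℕ.+-identityʳ (f a) ⟩
  f a                     ∎
  where
  open ≡-Reasoning
  a≤N = ℕ.≤-pred (ℕ.≤∧≢⇒< a≤1+N (≢-sym 1+N≢a))

≐-refl : ∀ {A} → A ≐ A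
≐-refl _ _ _ _ = refl

≐-sym : ∀ {A B} → A ≐ B → B ≐ A
≐-sym A≐B i j 1≤i 1≤j = sym (A≐B i j 1≤i 1≤j)

≐-trans : ∀ {A B C} → A ≐ B → B ≐ C → A ≐ C
≐-trans A≐B B≐C i j 1≤i 1≤j = trans (A≐B i j 1≤i 1≤j) (B≐C i j 1≤i 1≤j)

≡⇒≐ : ∀ {A B} → (∀ i j → A i j ≡ B i j) → A ≐ B
≡⇒≐ A≡B i j _ _ = A≡B i j

IsProduct-unique : ∀ {A B C C'} → IsProduct A B C → IsProduct A B C' → C ≐ C'
IsProduct-unique AB=C AB=C' i j 1≤i 1≤j with AB=C i j 1≤i 1≤j | AB=C' i j 1≤i 1≤j
... | N , sum≡C | N' , sum≡C' =
  trans (sym (sum≡C (N ℕ.⊔ N') (ℕ.m≤m⊔n N N'))) (sum≡C' (N ℕ.⊔ N') (ℕ.m≤n⊔m N N'))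

IsProduct-resp-≐ : ∀ {A A' B B' C C'} → A ≐ A' → B ≐ B' → C ≐ C' →
                   IsProduct A B C → IsProduct A' B' C'
IsProduct-resp-≐ A≐A' B≐B' C≐C' AB=C i j 1≤i 1≤j with AB=C i j 1≤i 1≤j
... | N , sum≡C = N , λ N' N≤N' →
  trans (sumTo-cong N' (λ l 1≤l → sym (cong₂ ℕ._*_ (A≐A' i l 1≤i 1≤l) (B≐B' l j 1≤l 1≤j))))
        (trans (sum≡C N' N≤N') (C≐C' i j 1≤i 1≤j))

IsProduct-respʳ-≐ : ∀ A B {C C'} → C ≐ C' → IsProduct A B C → IsProduct A B C'
IsProduct-respʳ-≐ A B = IsProduct-resp-≐ {A} {A} {B} {B} ≐-refl ≐-refl

IsProduct-unique-≐ : ∀ A B {A' B' C C'} → A ≐ A' → B ≐ B' →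
                     IsProduct A B C → IsProduct A' B' C' → C ≐ C'
IsProduct-unique-≐ A B {A'} {B'} {C} A≐A' B≐B' AB=C =
  IsProduct-unique {A'} {B'} (IsProduct-resp-≐ {A} {A'} {B} {B'} {C} A≐A' B≐B' ≐-refl AB=C)

IsProduct-zeroʳ : ∀ A → IsProduct A 𝟎 𝟎
IsProduct-zeroʳ A i j _ _ = 0 , λ N _ → sumTo-zero N (λ l _ → ℕ.*-zeroʳ (A i l))

IsProduct-zeroˡ : ∀ B → IsProduct 𝟎 B 𝟎
IsProduct-zeroˡ B i j _ _ = 0 , λ N _ → sumTo-zero N (λ _ _ → refl)

-- Graphs of partial maps

PartialMap : Set
PartialMap = ℕ → Maybe ℕ

_⨾_ : PartialMap → PartialMap → PartialMap
(f ⨾ g) i = f i >>= g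

⨾-assoc : ∀ f g h i → ((f ⨾ g) ⨾ h) i ≡ (f ⨾ (g ⨾ h)) i
⨾-assoc f g h i with f i
... | nothing = refl
... | just _  = refl

⨾-congʳ : ∀ f {g h} → (∀ a → g a ≡ h a) → ∀ i → (f ⨾ g) i ≡ (f ⨾ h) i
⨾-congʳ f g≡h i with f i
... | nothing = refl
... | just a  = g≡h a

⨾-nothingʳ : ∀ f i → (f ⨾ (λ _ → nothing)) i ≡ nothing
⨾-nothingʳ f i with f i
... | nothing = refl
... | just _  = refl

just≢nothing : ∀ {A : Set} {a : A} → just a ≢ nothing
just≢nothing ()

Maybe-≡ : ∀ {A : Set} {o o' : Maybe A} →
          (∀ {a} → o ≡ just a → o' ≡ just a) → (∀ {a} → o' ≡ just a → o ≡ just a) → o ≡ o'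
Maybe-≡ {o = just a}                 o⇒o' _    = sym (o⇒o' refl)
Maybe-≡ {o = nothing} {o' = just a}  _    o'⇒o = o'⇒o refl
Maybe-≡ {o = nothing} {o' = nothing} _    _    = refl

indicator : Maybe ℕ → ℕ → ℕ
indicator nothing  j = 0
indicator (just a) j with a ℕ.≟ j
... | yes _ = 1
... | no  _ = 0

indicator-self : ∀ a → indicator (just a) a ≡ 1
indicator-self a with a ℕ.≟ a
... | yes _   = refl
... | no  a≢a = contradiction refl a≢a

indicator-≢ : ∀ {a j} → j ≢ a → indicator (just a) j ≡ 0
indicator-≢ {a} {j} j≢a with a ℕ.≟ j
... | yes a≡j = contradiction (sym a≡j) j≢a
... | no  _   = refl

indicator≡1⇒≡just : ∀ o {j} → indicator o j ≡ 1 → o ≡ just j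
indicator≡1⇒≡just (just a) {j} _ with a ℕ.≟ j
... | yes refl = refl
indicator≡1⇒≡just nothing ()

graph : PartialMap → Mat
graph f i j = indicator (f i) j

graph-cong : ∀ {f g} → (∀ i → f i ≡ g i) → graph f ≐ graph g
graph-cong f≡g = ≡⇒≐ (λ i j → cong (λ o → indicator o j) (f≡g i))

-- Row and column 0 are invisible to IsProduct and _≐_, so a composite is reflected by the
-- matrix product only if the intermediate values are ≥ 1.
PositiveValued : PartialMap → Set
PositiveValued f = ∀ i {a} → f i ≡ just a → 1 ℕ.≤ a

graph-⨾ : ∀ f g → PositiveValued f → IsProduct (graph f) (graph g) (graph (f ⨾ g))
graph-⨾ f g f>0 i j _ _ with f i in fi≡
... | nothing = 0 , λ N _ → sumTo-zero N (λ _ _ → refl)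
... | just a  = a , λ N a≤N → trans (sumTo-single N off-diagonal (f>0 i fi≡) a≤N) on-diagonal
  where
  off-diagonal : ∀ l → l ≢ a → indicator (just a) l ℕ.* graph g l j ≡ 0
  off-diagonal l l≢a = cong (ℕ._* graph g l j) (indicator-≢ l≢a)
  on-diagonal : indicator (just a) a ℕ.* graph g a j ≡ graph g a j
  on-diagonal = trans (cong (ℕ._* graph g a j) (indicator-self a)) (ℕ.*-identityˡ (graph g a j))

graph-≐-just : ∀ {f g i a} → PositiveValued f → graph f ≐ graph g → 1 ℕ.≤ i →
               f i ≡ just a → g i ≡ just a
graph-≐-just {f} {g} {i} {a} f>0 f≐g 1≤i fi≡a = indicator≡1⇒≡just (g i) (begin
  graph g i a          ≡⟨ f≐g i a 1≤i (f>0 i fi≡a) ⟨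
  indicator (f i) a    ≡⟨ cong (λ o → indicator o a) fi≡a ⟩
  indicator (just a) a ≡⟨ indicator-self a ⟩
  1                    ∎)
  where open ≡-Reasoning

graph-injective : ∀ {f g} → PositiveValued f → PositiveValued g → graph f ≐ graph g →
                  ∀ i → 1 ℕ.≤ i → f i ≡ g i
graph-injective {f} {g} f>0 g>0 f≐g i 1≤i =
  Maybe-≡ (graph-≐-just {f} {g} f>0 f≐g 1≤i) (graph-≐-just {g} {f} g>0 (≐-sym f≐g) 1≤i)

i-j+j≡i : ∀ i j → i ℤ.- j ℤ.+ j ≡ i
i-j+j≡i = solve-∀

i+j-j≡i : ∀ i j → i ℤ.+ j ℤ.- j ≡ i
i+j-j≡i = solve-∀

i+j-i≡j : ∀ i j → i ℤ.+ j ℤ.- i ≡ j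
i+j-i≡j = solve-∀

i+[j-i]≡j : ∀ i j → i ℤ.+ (j ℤ.- i) ≡ j
i+[j-i]≡j = solve-∀

i+∣j-i∣≡j : ∀ {i j} → i ℤ.≤ j → i ℤ.+ + ℤ.∣ j ℤ.- i ∣ ≡ j
i+∣j-i∣≡j {i} {j} i≤j =
  trans (cong (λ x → i ℤ.+ x) (ℤ.0≤i⇒+∣i∣≡i (ℤ.i≤j⇒0≤j-i i≤j))) (i+[j-i]≡j i j)

i+d≡j⇔j-i≡d : ∀ i j d → (i ℤ.+ d ≡ j) ⇔ (j ℤ.- i ≡ d)
i+d≡j⇔j-i≡d i j d = mk⇔
  (λ i+d≡j → trans (cong (ℤ._- i) (sym i+d≡j)) (i+j-i≡j i d))
  (λ j-i≡d → trans (cong (λ x → i ℤ.+ x) (sym j-i≡d)) (i+[j-i]≡j i j))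

+-cancelˡ-≡ : ∀ i {j k} → i ℤ.+ j ≡ i ℤ.+ k → j ≡ k
+-cancelˡ-≡ i {j} {k} i+j≡i+k =
  trans (sym (to (i+d≡j⇔j-i≡d i (i ℤ.+ k) j) i+j≡i+k)) (to (i+d≡j⇔j-i≡d i (i ℤ.+ k) k) refl)
  where open Equivalence

i-k≤j⇔i≤j+k : ∀ i j k → (i ℤ.- k ℤ.≤ j) ⇔ (i ℤ.≤ j ℤ.+ k)
i-k≤j⇔i≤j+k i j k = mk⇔
  (λ i-k≤j → subst (ℤ._≤ j ℤ.+ k) (i-j+j≡i i k) (ℤ.+-monoˡ-≤ k i-k≤j))
  (λ i≤j+k → subst (i ℤ.- k ℤ.≤_) (i+j-j≡i j k) (ℤ.+-monoˡ-≤ (ℤ.- k) i≤j+k))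

i≤j-k⇔i+k≤j : ∀ i j k → (i ℤ.≤ j ℤ.- k) ⇔ (i ℤ.+ k ℤ.≤ j)
i≤j-k⇔i+k≤j i j k = mk⇔
  (λ i≤j-k → subst (i ℤ.+ k ℤ.≤_) (i-j+j≡i j k) (ℤ.+-monoˡ-≤ k i≤j-k))
  (λ i+k≤j → subst (ℤ._≤ j ℤ.- k) (i+j-j≡i i k) (ℤ.+-monoˡ-≤ (ℤ.- k) i+k≤j))

1≤i⇒+∣i∣≡i : ∀ {i} → + 1 ℤ.≤ i → + ℤ.∣ i ∣ ≡ i
1≤i⇒+∣i∣≡i 1≤i = ℤ.0≤i⇒+∣i∣≡i (ℤ.≤-trans (ℤ.+≤+ z≤n) 1≤i)

1≤i⇒1≤∣i∣ : ∀ {i} → + 1 ℤ.≤ i → 1 ℕ.≤ ℤ.∣ i ∣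
1≤i⇒1≤∣i∣ 1≤i = ℤ.drop‿+≤+ (subst (+ 1 ℤ.≤_) (sym (1≤i⇒+∣i∣≡i 1≤i)) 1≤i)

infix 4 _∈[_,_] _∈?[_,_]

_∈[_,_] : ℤ → ℤ → ℤ → Set
x ∈[ k , m ] = k ℤ.≤ x × x ℤ.≤ m

_∈?[_,_] : ∀ x k m → Dec (x ∈[ k , m ])
x ∈?[ k , m ] = k ℤ.≤? x ×-dec x ℤ.≤? m

∈⇒nonempty : ∀ {x k m} → x ∈[ k , m ] → k ℤ.≤ m
∈⇒nonempty (k≤x , x≤m) = ℤ.≤-trans k≤x x≤m

∣start∣∈ : ∀ {k m} → + 1 ℤ.≤ k → k ℤ.≤ m → + ℤ.∣ k ∣ ∈[ k , m ]
∣start∣∈ {k} {m} 1≤k k≤m = subst (_∈[ k , m ]) (sym (1≤i⇒+∣i∣≡i 1≤k)) (ℤ.≤-refl , k≤m)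

∈-shifted-meet : ∀ x d k m k' m' →
  x ∈[ k ⊔ (k' ℤ.- d) , m ⊓ (m' ℤ.- d) ] ⇔ (x ∈[ k , m ] × x ℤ.+ d ∈[ k' , m' ])
∈-shifted-meet x d k m k' m' = mk⇔
  (λ (lo≤x , x≤hi) →
      (ℤ.i⊔j≤k⇒i≤k k _ lo≤x , ℤ.i≤j⊓k⇒i≤j m _ x≤hi)
    , (to (i-k≤j⇔i≤j+k k' x d) (ℤ.i⊔j≤k⇒j≤k k _ lo≤x)
    ,  to (i≤j-k⇔i+k≤j x m' d) (ℤ.i≤j⊓k⇒i≤k m _ x≤hi)))
  (λ ((k≤x , x≤m) , (k'≤x+d , x+d≤m')) →
      ℤ.⊔-lub k≤x (from (i-k≤j⇔i≤j+k k' x d) k'≤x+d)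
    , ℤ.⊓-glb x≤m (from (i≤j-k⇔i+k≤j x m' d) x+d≤m'))
  where open Equivalence

minRow : ℤ → ℤ
minRow d = + 1 ℤ.- (+ 0 ⊓ d)

minRow≡1⊔1-d : ∀ d → minRow d ≡ + 1 ⊔ (+ 1 ℤ.- d)
minRow≡1⊔1-d = ℤ.antimono-≤-distrib-⊓ (λ x≤y → ℤ.+-monoʳ-≤ (+ 1) (ℤ.neg-mono-≤ x≤y)) (+ 0)

minRow≤⇔ : ∀ d k → (minRow d ℤ.≤ k) ⇔ (+ 1 ℤ.≤ k × + 1 ℤ.≤ k ℤ.+ d)
minRow≤⇔ d k rewrite minRow≡1⊔1-d d = mk⇔
  (λ lo≤k → ℤ.i⊔j≤k⇒i≤k (+ 1) _ lo≤k , to (i-k≤j⇔i≤j+k (+ 1) k d) (ℤ.i⊔j≤k⇒j≤k (+ 1) _ lo≤k))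
  (λ (1≤k , 1≤k+d) → ℤ.⊔-lub 1≤k (from (i-k≤j⇔i≤j+k (+ 1) k d) 1≤k+d))
  where open Equivalence

minRow≤⇒1≤ : ∀ d {k} → minRow d ℤ.≤ k → + 1 ℤ.≤ k
minRow≤⇒1≤ d {k} = proj₁ ∘ Equivalence.to (minRow≤⇔ d k)

minRow≤⇒1≤+ : ∀ d {k} → minRow d ℤ.≤ k → + 1 ℤ.≤ k ℤ.+ d
minRow≤⇒1≤+ d {k} = proj₂ ∘ Equivalence.to (minRow≤⇔ d k)

minRow-product : ∀ d k d' k' → minRow d ℤ.≤ k → minRow d' ℤ.≤ k' →
                 minRow (d ℤ.+ d') ℤ.≤ k ⊔ (k' ℤ.- d)
minRow-product d k d' k' lo≤k lo'≤k' = Equivalence.from (minRow≤⇔ (d ℤ.+ d') _)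
  (ℤ.≤-trans (minRow≤⇒1≤ d lo≤k) (ℤ.i≤i⊔j k _) , 1≤k''+d'')
  where
  k'-d+[d+d']≡k'+d' : ∀ k' d d' → k' ℤ.- d ℤ.+ (d ℤ.+ d') ≡ k' ℤ.+ d'
  k'-d+[d+d']≡k'+d' = solve-∀
  1≤k''+d'' : + 1 ℤ.≤ k ⊔ (k' ℤ.- d) ℤ.+ (d ℤ.+ d')
  1≤k''+d'' = ℤ.≤-trans (subst (+ 1 ℤ.≤_) (sym (k'-d+[d+d']≡k'+d' k' d d')) (minRow≤⇒1≤+ d' lo'≤k'))
                        (ℤ.+-monoˡ-≤ (d ℤ.+ d') (ℤ.i≤j⊔i k _))

-- Partial shifts

-- ∣_∣ only matters where i + d < 0, which never happens on an admissible triple.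
shift : ℤ → ℤ → ℤ → PartialMap
shift d k m i with + i ∈?[ k , m ]
... | yes _ = just ℤ.∣ + i ℤ.+ d ∣
... | no  _ = nothing

shift-∈ : ∀ {d k m i} → + i ∈[ k , m ] → shift d k m i ≡ just ℤ.∣ + i ℤ.+ d ∣
shift-∈ {d} {k} {m} {i} i∈ with + i ∈?[ k , m ]
... | yes _  = refl
... | no  i∉ = contradiction i∈ i∉

shift-∉ : ∀ {d k m i} → ¬ + i ∈[ k , m ] → shift d k m i ≡ nothing
shift-∉ {d} {k} {m} {i} i∉ with + i ∈?[ k , m ]
... | yes i∈ = contradiction i∈ i∉
... | no  _  = refl

shift-just⇒∈ : ∀ {d k m i a} → shift d k m i ≡ just a → + i ∈[ k , m ]
shift-just⇒∈ {d} {k} {m} {i} _  with + i ∈?[ k , m ]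
shift-just⇒∈                 _  | yes i∈ = i∈
shift-just⇒∈                 () | no  _

shift-empty : ∀ {d k m} → ¬ k ℤ.≤ m → ∀ i → shift d k m i ≡ nothing
shift-empty k≰m i = shift-∉ (k≰m ∘ ∈⇒nonempty)

shift-nonvanishing : ∀ {d k m} → + 1 ℤ.≤ k → k ℤ.≤ m → ¬ (∀ i → 1 ℕ.≤ i → shift d k m i ≡ nothing)
shift-nonvanishing {d} 1≤k k≤m vanishes =
  just≢nothing (trans (sym (shift-∈ {d} (∣start∣∈ 1≤k k≤m))) (vanishes _ (1≤i⇒1≤∣i∣ 1≤k)))

shift-target : ∀ {d k} i → + 1 ℤ.≤ k ℤ.+ d → k ℤ.≤ + i → + ℤ.∣ + i ℤ.+ d ∣ ≡ + i ℤ.+ d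
shift-target {d} i 1≤k+d k≤i = 1≤i⇒+∣i∣≡i (ℤ.≤-trans 1≤k+d (ℤ.+-monoˡ-≤ d k≤i))

shift-just⇒value : ∀ {d k m i a} → + 1 ℤ.≤ k ℤ.+ d → shift d k m i ≡ just a → + a ≡ + i ℤ.+ d
shift-just⇒value {d} {k} {m} {i} 1≤k+d shift≡a = begin
  + _                 ≡⟨ cong +_ (just-injective (trans (sym shift≡a) (shift-∈ {d} i∈))) ⟩
  + ℤ.∣ + i ℤ.+ d ∣   ≡⟨ shift-target i 1≤k+d (proj₁ i∈) ⟩
  + i ℤ.+ d           ∎
  where
  open ≡-Reasoning
  i∈ = shift-just⇒∈ {d} {k} {m} {i} shift≡a

shift-positive : ∀ {d k m} → + 1 ℤ.≤ k ℤ.+ d → PositiveValued (shift d k m)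
shift-positive {d} {k} {m} 1≤k+d i {a} shift≡a = ℤ.drop‿+≤+ (begin
  + 1         ≤⟨ 1≤k+d ⟩
  k ℤ.+ d     ≤⟨ ℤ.+-monoˡ-≤ d (proj₁ (shift-just⇒∈ {d} {k} {m} {i} shift≡a)) ⟩
  + i ℤ.+ d   ≡⟨ shift-just⇒value 1≤k+d shift≡a ⟨
  + a         ∎)
  where open ℤ.≤-Reasoning

⟨⟩≡graph-shift : ∀ d k m → + 1 ℤ.≤ k ℤ.+ d → ∀ i j → ⟨ d , k , m ⟩ i j ≡ graph (shift d k m) i j
⟨⟩≡graph-shift d k m 1≤k+d i j with k ℤ.≤? + i | + i ℤ.≤? m
... | no  _   | _     = refl
... | yes _   | no  _ = refl
... | yes k≤i | yes _ with (+ j ℤ.- + i) ℤ.≟ d | ℤ.∣ + i ℤ.+ d ∣ ℕ.≟ j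
...   | yes _     | yes _    = refl
...   | no  _     | no  _    = refl
...   | yes j-i≡d | no  ∣∣≢j =
  contradiction (cong ℤ.∣_∣ (Equivalence.from (i+d≡j⇔j-i≡d (+ i) (+ j) d) j-i≡d)) ∣∣≢j
...   | no  j-i≢d | yes ∣∣≡j =
  contradiction (Equivalence.to (i+d≡j⇔j-i≡d (+ i) (+ j) d)
                  (trans (sym (shift-target i 1≤k+d k≤i)) (cong +_ ∣∣≡j))) j-i≢d

⟨⟩≐graph-shift : ∀ {d k m} → minRow d ℤ.≤ k → ⟨ d , k , m ⟩ ≐ graph (shift d k m)
⟨⟩≐graph-shift {d} {k} {m} lo≤k = ≡⇒≐ (⟨⟩≡graph-shift d k m (minRow≤⇒1≤+ d lo≤k))

shift-⨾ : ∀ d k m d' k' m' → + 1 ℤ.≤ k ℤ.+ d → ∀ i →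
  (shift d k m ⨾ shift d' k' m') i ≡ shift (d ℤ.+ d') (k ⊔ (k' ℤ.- d)) (m ⊓ (m' ℤ.- d)) i
shift-⨾ d k m d' k' m' 1≤k+d i with + i ∈?[ k ⊔ (k' ℤ.- d) , m ⊓ (m' ℤ.- d) ]
... | yes i∈'' = begin
  (shift d k m ⨾ shift d' k' m') i   ≡⟨ cong (_>>= shift d' k' m') (shift-∈ {d} i∈) ⟩
  shift d' k' m' ℤ.∣ + i ℤ.+ d ∣      ≡⟨ shift-∈ {d'} (subst (_∈[ k' , m' ]) (sym target) i+d∈) ⟩
  just ℤ.∣ + ℤ.∣ + i ℤ.+ d ∣ ℤ.+ d' ∣ ≡⟨ cong (λ x → just ℤ.∣ x ℤ.+ d' ∣) target ⟩
  just ℤ.∣ + i ℤ.+ d ℤ.+ d' ∣         ≡⟨ cong (just ∘ ℤ.∣_∣) (ℤ.+-assoc (+ i) d d') ⟩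
  just ℤ.∣ + i ℤ.+ (d ℤ.+ d') ∣       ∎
  where
  open ≡-Reasoning
  i∈ = proj₁ (Equivalence.to (∈-shifted-meet (+ i) d k m k' m') i∈'')
  i+d∈ = proj₂ (Equivalence.to (∈-shifted-meet (+ i) d k m k' m') i∈'')
  target = shift-target i 1≤k+d (proj₁ i∈)
... | no i∉'' with + i ∈?[ k , m ]
...   | no  _  = refl
...   | yes i∈ = shift-∉ {d'} i+d∉
  where
  i+d∉ : ¬ + ℤ.∣ + i ℤ.+ d ∣ ∈[ k' , m' ]
  i+d∉ i+d∈ = i∉'' (Equivalence.from (∈-shifted-meet (+ i) d k m k' m')
    (i∈ , subst (_∈[ k' , m' ]) (shift-target i 1≤k+d (proj₁ i∈)) i+d∈))

shift-agree⇒bounds : ∀ {d k m d' k' m'} → + 1 ℤ.≤ k → k ℤ.≤ m →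
  (∀ i → 1 ℕ.≤ i → shift d k m i ≡ shift d' k' m' i) → k' ℤ.≤ k × m ℤ.≤ m'
shift-agree⇒bounds {d} {k} {m} {d'} {k'} {m'} 1≤k k≤m agree =
  proj₁ (transfer (ℤ.≤-refl , k≤m)) , proj₂ (transfer (k≤m , ℤ.≤-refl))
  where
  transfer : ∀ {x} → x ∈[ k , m ] → x ∈[ k' , m' ]
  transfer {x} x∈ = subst (_∈[ k' , m' ]) (1≤i⇒+∣i∣≡i 1≤x)
    (shift-just⇒∈ {d'} (trans (sym (agree ℤ.∣ x ∣ (1≤i⇒1≤∣i∣ 1≤x))) (shift-∈ {d} ∣x∣∈)))
    where
    1≤x = ℤ.≤-trans 1≤k (proj₁ x∈)
    ∣x∣∈ = subst (_∈[ k , m ]) (sym (1≤i⇒+∣i∣≡i 1≤x)) x∈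

shift-injective : ∀ {d k m d' k' m'} → minRow d ℤ.≤ k → k ℤ.≤ m → minRow d' ℤ.≤ k' → k' ℤ.≤ m' →
  (∀ i → 1 ℕ.≤ i → shift d k m i ≡ shift d' k' m' i) → d ≡ d' × k ≡ k' × m ≡ m'
shift-injective {d} {k} {m} {d'} {k'} {m'} lo≤k k≤m lo'≤k' k'≤m' agree =
  +-cancelˡ-≡ (+ ℤ.∣ k ∣) (sym k+d'≡k+d) , k≡k' , ℤ.≤-antisym (proj₂ bounds) (proj₂ bounds')
  where
  1≤k = minRow≤⇒1≤ d lo≤k
  bounds = shift-agree⇒bounds 1≤k k≤m agree
  bounds' = shift-agree⇒bounds (minRow≤⇒1≤ d' lo'≤k') k'≤m' (λ i 1≤i → sym (agree i 1≤i))
  k≡k' = ℤ.≤-antisym (proj₁ bounds') (proj₁ bounds)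
  k∈ = ∣start∣∈ 1≤k k≤m
  k+d'≡k+d : + ℤ.∣ k ∣ ℤ.+ d' ≡ + ℤ.∣ k ∣ ℤ.+ d
  k+d'≡k+d = trans
    (sym (shift-just⇒value (minRow≤⇒1≤+ d' lo'≤k')
                           (trans (sym (agree _ (1≤i⇒1≤∣i∣ 1≤k))) (shift-∈ {d} k∈))))
    (shift-target _ (minRow≤⇒1≤+ d lo≤k) (proj₁ k∈))

module _ (d k m d' k' m' : ℤ) (lo≤k : minRow d ℤ.≤ k) (lo'≤k' : minRow d' ℤ.≤ k') where

  private
    k'' = k ⊔ (k' ℤ.- d)
    m'' = m ⊓ (m' ℤ.- d)

  ⟨⟩-isProduct-graph : IsProduct ⟨ d , k , m ⟩ ⟨ d' , k' , m' ⟩ (graph (shift (d ℤ.+ d') k'' m''))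
  ⟨⟩-isProduct-graph =
    IsProduct-resp-≐ (≐-sym (⟨⟩≐graph-shift lo≤k)) (≐-sym (⟨⟩≐graph-shift lo'≤k'))
                     (graph-cong (shift-⨾ d k m d' k' m' 1≤k+d))
                     (graph-⨾ (shift d k m) (shift d' k' m') (shift-positive 1≤k+d))
    where 1≤k+d = minRow≤⇒1≤+ d lo≤k

  ⟨⟩-isProduct-≤ : k'' ℤ.≤ m'' → IsProduct ⟨ d , k , m ⟩ ⟨ d' , k' , m' ⟩ ⟨ d ℤ.+ d' , k'' , m'' ⟩
  ⟨⟩-isProduct-≤ _ = IsProduct-respʳ-≐ ⟨ d , k , m ⟩ ⟨ d' , k' , m' ⟩
    (≐-sym (⟨⟩≐graph-shift (minRow-product d k d' k' lo≤k lo'≤k'))) ⟨⟩-isProduct-graph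

  ⟨⟩-isProduct-> : m'' ℤ.< k'' → IsProduct ⟨ d , k , m ⟩ ⟨ d' , k' , m' ⟩ 𝟎
  ⟨⟩-isProduct-> m''<k'' = IsProduct-respʳ-≐ ⟨ d , k , m ⟩ ⟨ d' , k' , m' ⟩
    (graph-cong (shift-empty (ℤ.<⇒≱ m''<k''))) ⟨⟩-isProduct-graph

partialMap : S∞ → PartialMap
partialMap zeroS           _ = nothing
partialMap (tri d k m _ _)   = shift d k m

partialMap-positive : ∀ x → PositiveValued (partialMap x)
partialMap-positive zeroS              _ ()
partialMap-positive (tri d k m lo≤k _)   = shift-positive (minRow≤⇒1≤+ d lo≤k)

toMat≐graph : ∀ x → toMat x ≐ graph (partialMap x)
toMat≐graph zeroS              = ≐-refl
toMat≐graph (tri d k m lo≤k _) = ⟨⟩≐graph-shift lo≤k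

infixl 7 _·_
_·_ : S∞ → S∞ → S∞
zeroS            · _                       = zeroS
tri _ _ _ _ _    · zeroS                   = zeroS
tri d k m lo≤k _ · tri d' k' m' lo'≤k' _ with k ⊔ (k' ℤ.- d) ℤ.≤? m ⊓ (m' ℤ.- d)
... | yes k''≤m'' = tri (d ℤ.+ d') _ _ (minRow-product d k d' k' lo≤k lo'≤k') k''≤m''
... | no  _       = zeroS

partialMap-· : ∀ x y i → partialMap (x · y) i ≡ (partialMap x ⨾ partialMap y) i
partialMap-· zeroS              _                  _ = refl
partialMap-· (tri d k m _ _)    zeroS              i = sym (⨾-nothingʳ (shift d k m) i)
partialMap-· (tri d k m lo≤k _) (tri d' k' m' _ _) i with k ⊔ (k' ℤ.- d) ℤ.≤? m ⊓ (m' ℤ.- d)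
... | yes _       = sym (shift-⨾ d k m d' k' m' (minRow≤⇒1≤+ d lo≤k) i)
... | no  k''≰m'' = sym (trans (shift-⨾ d k m d' k' m' (minRow≤⇒1≤+ d lo≤k) i) (shift-empty k''≰m'' i))

·-isProduct : ∀ x y → IsProduct (toMat x) (toMat y) (toMat (x · y))
·-isProduct x y =
  IsProduct-resp-≐ (≐-sym (toMat≐graph x)) (≐-sym (toMat≐graph y))
    (≐-trans (graph-cong (λ i → sym (partialMap-· x y i))) (≐-sym (toMat≐graph (x · y))))
    (graph-⨾ (partialMap x) (partialMap y) (partialMap-positive x))

·-assoc : ∀ x y z → toMat ((x · y) · z) ≐ toMat (x · (y · z))
·-assoc x y z = ≐-trans (toMat≐graph ((x · y) · z))
                        (≐-trans (graph-cong pointwise) (≐-sym (toMat≐graph (x · (y · z)))))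
  where
  open ≡-Reasoning
  pointwise : ∀ i → partialMap ((x · y) · z) i ≡ partialMap (x · (y · z)) i
  pointwise i = begin
    partialMap ((x · y) · z) i
      ≡⟨ partialMap-· (x · y) z i ⟩
    (partialMap (x · y) ⨾ partialMap z) i
      ≡⟨ cong (_>>= partialMap z) (partialMap-· x y i) ⟩
    ((partialMap x ⨾ partialMap y) ⨾ partialMap z) i
      ≡⟨ ⨾-assoc (partialMap x) (partialMap y) (partialMap z) i ⟩
    (partialMap x ⨾ (partialMap y ⨾ partialMap z)) i
      ≡⟨ ⨾-congʳ (partialMap x) (λ a → sym (partialMap-· y z a)) i ⟩
    (partialMap x ⨾ partialMap (y · z)) i
      ≡⟨ partialMap-· x (y · z) i ⟨
    partialMap (x · (y · z)) i
      ∎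

IsProduct-assoc : ∀ (x y z xy yz p q : S∞) →
  IsProduct (toMat x) (toMat y) (toMat xy) → IsProduct (toMat xy) (toMat z) (toMat p) →
  IsProduct (toMat y) (toMat z) (toMat yz) → IsProduct (toMat x) (toMat yz) (toMat q) →
  toMat p ≐ toMat q
IsProduct-assoc x y z xy yz p q xy= p= yz= q= =
  ≐-trans p≐[xy]z (≐-trans (·-assoc x y z) (≐-sym q≐x[yz]))
  where
  xy≐x·y = IsProduct-unique {toMat x} {toMat y} xy= (·-isProduct x y)
  yz≐y·z = IsProduct-unique {toMat y} {toMat z} yz= (·-isProduct y z)
  p≐[xy]z = IsProduct-unique-≐ (toMat xy) (toMat z) xy≐x·y ≐-refl p= (·-isProduct (x · y) z)
  q≐x[yz] = IsProduct-unique-≐ (toMat x) (toMat yz) ≐-refl yz≐y·z q= (·-isProduct x (y · z))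

·-noncommutative : ∃ λ x → ∃ λ y → ¬ (toMat (x · y) ≐ toMat (y · x))
·-noncommutative = e₁₂ , e₂₁ , λ e₁₁≐e₂₂ → 1≢0 (e₁₁≐e₂₂ 1 1 (s≤s z≤n) (s≤s z≤n))
  where
  e₁₂ = tri (+ 1) (+ 1) (+ 1) ℤ.≤-refl ℤ.≤-refl
  e₂₁ = tri (ℤ.- + 1) (+ 2) (+ 2) ℤ.≤-refl ℤ.≤-refl
  1≢0 : 1 ≢ 0
  1≢0 ()

tri-≡ : ∀ {d k m d' k' m' p q p' q'} → d ≡ d' × k ≡ k' × m ≡ m' → tri d k m p q ≡ tri d' k' m' p' q'
tri-≡ {p = p} {q} {p'} {q'} (refl , refl , refl) =
  cong₂ (tri _ _ _) (ℤ.≤-irrelevant p p') (ℤ.≤-irrelevant q q')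

partialMap-injective : ∀ x y → (∀ i → 1 ℕ.≤ i → partialMap x i ≡ partialMap y i) → x ≡ y
partialMap-injective zeroS zeroS _ = refl
partialMap-injective zeroS (tri d k m lo≤k k≤m) agree =
  ⊥-elim (shift-nonvanishing (minRow≤⇒1≤ d lo≤k) k≤m (λ i 1≤i → sym (agree i 1≤i)))
partialMap-injective (tri d k m lo≤k k≤m) zeroS agree =
  ⊥-elim (shift-nonvanishing (minRow≤⇒1≤ d lo≤k) k≤m agree)
partialMap-injective (tri d k m lo≤k k≤m) (tri d' k' m' lo'≤k' k'≤m') agree =
  tri-≡ (shift-injective lo≤k k≤m lo'≤k' k'≤m' agree)

toMat-injective : ∀ x y → toMat x ≐ toMat y → x ≡ y
toMat-injective x y x≐y = partialMap-injective x y
  (graph-injective (partialMap-positive x) (partialMap-positive y)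
    (≐-trans (≐-sym (toMat≐graph x)) (≐-trans x≐y (toMat≐graph y))))

-- Countability

triangle : ℕ → ℕ
triangle zero    = 0
triangle (suc s) = triangle s ℕ.+ suc s

pair : ℕ × ℕ → ℕ
pair (a , b) = triangle (a ℕ.+ b) ℕ.+ a

-- The successor of (a , b) when ℕ × ℕ is enumerated along the antidiagonals a + b = s.
next : ℕ × ℕ → ℕ × ℕ
next (a , suc b) = suc a , b
next (a , zero)  = zero , suc a

unpair : ℕ → ℕ × ℕ
unpair zero    = 0 , 0
unpair (suc n) = next (unpair n)

pair-next : ∀ p → pair (next p) ≡ suc (pair p)
pair-next (a , suc b) rewrite ℕ.+-suc a b = ℕ.+-suc (triangle (suc (a ℕ.+ b))) a
pair-next (a , zero)
  rewrite ℕ.+-identityʳ a | ℕ.+-identityʳ (triangle a ℕ.+ suc a) = ℕ.+-suc (triangle a) a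

pair-unpair : ∀ n → pair (unpair n) ≡ n
pair-unpair zero    = refl
pair-unpair (suc n) = trans (pair-next (unpair n)) (cong suc (pair-unpair n))

unpair-pair : ∀ p → unpair (pair p) ≡ p
unpair-pair (a , b) = go (a ℕ.+ b) a b refl
  where
  go : ∀ s a b → a ℕ.+ b ≡ s → unpair (pair (a , b)) ≡ (a , b)
  go _       zero    zero    _ = refl
  go s       (suc a) b       a+b≡s rewrite pair-next (a , suc b) =
    cong next (go s a (suc b) (trans (ℕ.+-suc a b) a+b≡s))
  go (suc s) zero    (suc b) b≡s rewrite pair-next (b , zero) =
    cong next (go s b zero (trans (ℕ.+-identityʳ b) (ℕ.suc-injective b≡s)))

ℕ×ℕ↔ℕ : (ℕ × ℕ) ↔ ℕ
ℕ×ℕ↔ℕ = mk↔ₛ′ pair unpair pair-unpair unpair-pair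

outward : ℤ → ℤ
outward (+ n)    = + suc n
outward -[1+ n ] = -[1+ suc n ]

ℤ→ℕ : ℤ → ℕ
ℤ→ℕ (+ n)    = n ℕ.+ n
ℤ→ℕ -[1+ n ] = suc (n ℕ.+ n)

ℕ→ℤ : ℕ → ℤ
ℕ→ℤ zero          = + 0
ℕ→ℤ (suc zero)    = -[1+ 0 ]
ℕ→ℤ (suc (suc n)) = outward (ℕ→ℤ n)

ℤ→ℕ-outward : ∀ z → ℤ→ℕ (outward z) ≡ suc (suc (ℤ→ℕ z))
ℤ→ℕ-outward (+ n)    = cong suc (ℕ.+-suc n n)
ℤ→ℕ-outward -[1+ n ] = cong (suc ∘ suc) (ℕ.+-suc n n)

ℤ→ℕ-ℕ→ℤ : ∀ n → ℤ→ℕ (ℕ→ℤ n) ≡ n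
ℤ→ℕ-ℕ→ℤ zero          = refl
ℤ→ℕ-ℕ→ℤ (suc zero)    = refl
ℤ→ℕ-ℕ→ℤ (suc (suc n)) = trans (ℤ→ℕ-outward (ℕ→ℤ n)) (cong (suc ∘ suc) (ℤ→ℕ-ℕ→ℤ n))

ℕ→ℤ-ℤ→ℕ : ∀ z → ℕ→ℤ (ℤ→ℕ z) ≡ z
ℕ→ℤ-ℤ→ℕ (+ zero)     = refl
ℕ→ℤ-ℤ→ℕ -[1+ zero ]  = refl
ℕ→ℤ-ℤ→ℕ (+ suc n)    = trans (cong ℕ→ℤ (ℤ→ℕ-outward (+ n))) (cong outward (ℕ→ℤ-ℤ→ℕ (+ n)))
ℕ→ℤ-ℤ→ℕ -[1+ suc n ] = trans (cong ℕ→ℤ (ℤ→ℕ-outward -[1+ n ])) (cong outward (ℕ→ℤ-ℤ→ℕ -[1+ n ]))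

ℤ↔ℕ : ℤ ↔ ℕ
ℤ↔ℕ = mk↔ₛ′ ℤ→ℕ ℕ→ℤ ℤ→ℕ-ℕ→ℤ ℕ→ℤ-ℤ→ℕ

Maybe-↔ℕ : ∀ {A : Set} → A ↔ ℕ → Maybe A ↔ ℕ
Maybe-↔ℕ {A} A↔ℕ = mk↔ₛ′ to′ from′ to′∘from′ from′∘to′
  where
  open Inverse A↔ℕ
  to′ : Maybe A → ℕ
  to′ nothing  = zero
  to′ (just a) = suc (to a)
  from′ : ℕ → Maybe A
  from′ zero    = nothing
  from′ (suc n) = just (from n)
  to′∘from′ : ∀ n → to′ (from′ n) ≡ n
  to′∘from′ zero    = refl
  to′∘from′ (suc n) = cong suc (strictlyInverseˡ n)
  from′∘to′ : ∀ o → from′ (to′ o) ≡ o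
  from′∘to′ nothing  = refl
  from′∘to′ (just a) = cong just (strictlyInverseʳ a)

S∞→code : S∞ → Maybe (ℤ × ℕ × ℕ)
S∞→code zeroS           = nothing
S∞→code (tri d k m _ _) = just (d , ℤ.∣ k ℤ.- minRow d ∣ , ℤ.∣ m ℤ.- k ∣)

code→S∞ : Maybe (ℤ × ℕ × ℕ) → S∞
code→S∞ nothing            = zeroS
code→S∞ (just (d , a , b)) =
  tri d (minRow d ℤ.+ + a) (minRow d ℤ.+ + a ℤ.+ + b) (ℤ.i≤i+j (minRow d) (+ a)) (ℤ.i≤i+j _ (+ b))

code→S∞-S∞→code : ∀ x → code→S∞ (S∞→code x) ≡ x
code→S∞-S∞→code zeroS                = refl
code→S∞-S∞→code (tri d k m lo≤k k≤m) =
  tri-≡ (refl , i+∣j-i∣≡j lo≤k , trans (cong (ℤ._+ _) (i+∣j-i∣≡j lo≤k)) (i+∣j-i∣≡j k≤m))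

S∞→code-code→S∞ : ∀ o → S∞→code (code→S∞ o) ≡ o
S∞→code-code→S∞ nothing = refl
S∞→code-code→S∞ (just (d , a , b))
  rewrite i+j-i≡j (minRow d) (+ a) | i+j-i≡j (minRow d ℤ.+ + a) (+ b) = refl

S∞↔ℕ : S∞ ↔ ℕ
S∞↔ℕ = ↔-trans (mk↔ₛ′ S∞→code code→S∞ S∞→code-code→S∞ code→S∞-S∞→code)
               (Maybe-↔ℕ (↔-trans (ℤ↔ℕ ×-↔ ℕ×ℕ↔ℕ) ℕ×ℕ↔ℕ))

theorem1 :
    (∀ (x y : S∞) → ∃ λ (z : S∞) → IsProduct (toMat x) (toMat y) (toMat z))
    × (∀ (x y z xy yz p q : S∞) →
         IsProduct (toMat x) (toMat y) (toMat xy) →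
         IsProduct (toMat xy) (toMat z) (toMat p) →
         IsProduct (toMat y) (toMat z) (toMat yz) →
         IsProduct (toMat x) (toMat yz) (toMat q) →
         toMat p ≐ toMat q)
    × (∃ λ (x : S∞) → ∃ λ (y : S∞) → ∃ λ (u : S∞) → ∃ λ (v : S∞) →
         IsProduct (toMat x) (toMat y) (toMat u)
         × IsProduct (toMat y) (toMat x) (toMat v)
         × ¬ (toMat u ≐ toMat v))
    × (∀ (x y : S∞) → toMat x ≐ toMat y → x ≡ y)
    × (S∞ ↔ ℕ)
    × (∀ (x : S∞) → IsProduct (toMat x) 𝟎 𝟎 × IsProduct 𝟎 (toMat x) 𝟎)
    × (∀ (d k m d' k' m' : ℤ) →
         (+ 1 ℤ.- (+ 0 ⊓ d)) ℤ.≤ k → k ℤ.≤ m →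
         (+ 1 ℤ.- (+ 0 ⊓ d')) ℤ.≤ k' → k' ℤ.≤ m' →
         ((k ⊔ (k' ℤ.- d)) ℤ.≤ (m ⊓ (m' ℤ.- d)) →
            IsProduct ⟨ d , k , m ⟩ ⟨ d' , k' , m' ⟩
                      ⟨ d ℤ.+ d' , k ⊔ (k' ℤ.- d) , m ⊓ (m' ℤ.- d) ⟩)
         × ((m ⊓ (m' ℤ.- d)) ℤ.< (k ⊔ (k' ℤ.- d)) →
            IsProduct ⟨ d , k , m ⟩ ⟨ d' , k' , m' ⟩ 𝟎)
         × ((+ 1 ℤ.- (+ 0 ⊓ (d ℤ.+ d'))) ℤ.≤ (k ⊔ (k' ℤ.- d))))
theorem1 =
    (λ x y → x · y , ·-isProduct x y)
  , IsProduct-assoc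
  , (let (x , y , xy≉yx) = ·-noncommutative
     in x , y , x · y , y · x , ·-isProduct x y , ·-isProduct y x , xy≉yx)
  , toMat-injective
  , S∞↔ℕ
  , (λ x → IsProduct-zeroʳ (toMat x) , IsProduct-zeroˡ (toMat x))
  , λ d k m d' k' m' lo≤k _ lo'≤k' _ →
        ⟨⟩-isProduct-≤ d k m d' k' m' lo≤k lo'≤k'
      , ⟨⟩-isProduct-> d k m d' k' m' lo≤k lo'≤k'
      , minRow-product d k d' k' lo≤k lo'≤k'
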